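{- For every instance and every work-conserving schedule $\mathcal{S}$, \[ F(\mathcal{OPT}) \;\ge\; \sum_{t\in\mathbb{N}} q(t) \;=\; \sum_{i=1}^{n}\sum_{t=r_i}^{c_i(\mathcal{S})} q_{t,\mathcal{S}}(i). \]
   Context: A single machine and $n$ jobs $J_1,\dots,J_n$; job $J_i$ has an integer release time $r_i\ge0$ and integer processing time $p_i\ge1$. Time is divided into unit slots $[t]=[t,t+1)$, $t\in\mathbb{N}=\{0,1,2,\dots\}$. A schedule $\mathcal{S}$ assigns to each slot at most one job so that $J_i$ is assigned exactly $p_i$ slots, all with $t\ge r_i$ (preemption allowed). $c_i(\mathcal{S})$ is $1$ plus the last slot assigned to $J_i$, $f_i(\mathcal{S})=c_i(\mathcal{S})-r_i$, $F(\mathcal{S})=\sum_i f_i(\mathcal{S})^2$, and $\mathcal{OPT}$ is a schedule minimizing $F$. $J_i$ is active at time $t$ under $\mathcal{S}$ if $r_i\le t<c_i(\mathcal{S})$; for active $i$, $q_{t,\mathcal{S}}(i)=p_i$ minus the number of slots $[t']$ with $t'<t$ assigned to $J_i$, and $q_{t,\mathcal{S}}(i)=0$ otherwise. $\mathcal{S}$ is work-conserving if for every $t\in\mathbb{N}$, whenever some job is active at $t$, some job is assigned slot $[t]$. For any $t$, $\sum_i q_{t,\mathcal{S}}(i)$ is the same for all work-conserving $\mathcal{S}$; this common value is denoted $q(t)$. -}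

module Defs where

open import Data.Nat using (ℕ; zero; suc; _+_; _*_; _∸_; _≤_; _<_; _<ᵇ_; _≤ᵇ_)
open import Data.Fin using (Fin) renaming (_≟_ to _≟ᶠ_)
open import Data.Maybe using (Maybe; just; nothing)
open import Data.Bool using (Bool; true; false; if_then_else_; _∧_)
open import Data.Product using (∃; _×_)
open import Relation.Nullary.Decidable using (⌊_⌋)
open import Relation.Binary.PropositionalEquality using (_≡_)
open import Relation.Nullary using (¬_)

sumTo : ℕ → (ℕ → ℕ) → ℕ
sumTo zero    f = 0
sumTo (suc N) f = sumTo N f + f N

-- Σ_{t = a}^{b} f t  (inclusive on both ends; 0 if b < a)
sumFromTo : ℕ → ℕ → (ℕ → ℕ) → ℕ
sumFromTo a b f = sumTo (suc b ∸ a) (λ k → f (a + k))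

sumFin : (n : ℕ) → (Fin n → ℕ) → ℕ
sumFin zero    f = 0
sumFin (suc n) f = f Fin.zero + sumFin n (λ i → f (Fin.suc i))

isJob : {n : ℕ} → Maybe (Fin n) → Fin n → Bool
isJob nothing  i = false
isJob (just j) i = ⌊ j ≟ᶠ i ⌋

count : {n : ℕ} → (ℕ → Maybe (Fin n)) → Fin n → ℕ → ℕ
count a i zero    = 0
count a i (suc T) = count a i T + (if isJob (a T) i then 1 else 0)

-- 1 + last slot < T assigned to job i (0 if none)
lastPlusOne : {n : ℕ} → (ℕ → Maybe (Fin n)) → Fin n → ℕ → ℕ
lastPlusOne a i zero    = 0
lastPlusOne a i (suc T) = if isJob (a T) i then suc T else lastPlusOne a i T

-- An instance: n jobs with release times r and processing times p.
-- A schedule assigns to each slot [t] at most one job (Maybe (Fin n)).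
record Schedule (n : ℕ) (r p : Fin n → ℕ) : Set where
  field
    assign   : ℕ → Maybe (Fin n)
    horizon  : ℕ
    empty    : ∀ t → horizon ≤ t → assign t ≡ nothing
    released : ∀ t i → assign t ≡ just i → r i ≤ t
    amount   : ∀ i → count assign i horizon ≡ p i
open Schedule public

module _ {n : ℕ} {r p : Fin n → ℕ} where

  completion : Schedule n r p → Fin n → ℕ
  completion S i = lastPlusOne (assign S) i (horizon S)

  flow : Schedule n r p → Fin n → ℕ
  flow S i = completion S i ∸ r i

  F : Schedule n r p → ℕ
  F S = sumFin n (λ i → flow S i * flow S i)

  Active : Schedule n r p → ℕ → Fin n → Set
  Active S t i = r i ≤ t × t < completion S i

  qi : Schedule n r p → ℕ → Fin n → ℕ
  qi S t i = if (r i ≤ᵇ t) ∧ (t <ᵇ completion S i)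
               then p i ∸ count (assign S) i t
               else 0

  q : Schedule n r p → ℕ → ℕ
  q S t = sumFin n (qi S t)

  WorkConserving : Schedule n r p → Set
  WorkConserving S = ∀ t → (∃ λ i → Active S t i) → ¬ (assign S t ≡ nothing)

  IsOptimal : Schedule n r p → Set
  IsOptimal O = ∀ (S : Schedule n r p) → F O ≤ F S

{-# OPTIONS --safe #-}
module Submission where

-- A work-conserving schedule S has processed, before every time t, at least as much
-- work as any other schedule A, while both face the same released work; hence the
-- total remaining work satisfies q_S(t) ≤ q_A(t). Summing over t and exchanging the
-- sums, Σ_t q_A(t) = Σ_i Σ_t q_{t,A}(i), and job i contributes at most p_i during
-- each of its f_i(A) active slots, with p_i ≤ f_i(A). So Σ_t q(t) ≤ F(A) for every
-- schedule A, in particular for OPT. The equality is the same exchange of sums for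
-- S itself, each inner sum being supported on [r_i, c_i(S)).

open import Defs
open import Data.Nat using (ℕ; zero; suc; _+_; _*_; _∸_; _≤_; _<_; _≥_; z≤n; s≤s; _≤?_; _<?_; _≤ᵇ_; _<ᵇ_)
open import Data.Nat.Properties
open import Data.Fin using (Fin) renaming (_≟_ to _≟ᶠ_)
open import Data.Maybe using (Maybe; just; nothing)
open import Data.Bool using (true; false; if_then_else_; _∧_)
open import Data.Sum using (inj₁; inj₂)
open import Data.Product using (_×_; _,_)
open import Relation.Nullary using (yes; no; ¬_; contradiction)
open import Relation.Nullary.Reflects using (ofʸ; ofⁿ)
open import Relation.Binary.PropositionalEquality

sumTo-mono : ∀ N {f g : ℕ → ℕ} → (∀ t → f t ≤ g t) → sumTo N f ≤ sumTo N g
sumTo-mono zero    f≤g = z≤n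
sumTo-mono (suc N) f≤g = +-mono-≤ (sumTo-mono N f≤g) (f≤g N)

sumTo-zero : ∀ K (f : ℕ → ℕ) → (∀ t → t < K → f t ≡ 0) → sumTo K f ≡ 0
sumTo-zero zero    f f≡0 = refl
sumTo-zero (suc K) f f≡0 = cong₂ _+_ (sumTo-zero K f (λ t t<K → f≡0 t (m≤n⇒m≤1+n t<K))) (f≡0 K ≤-refl)

sumTo-≤-* : ∀ K (f : ℕ → ℕ) b → (∀ t → f t ≤ b) → sumTo K f ≤ K * b
sumTo-≤-* zero    f b f≤b = z≤n
sumTo-≤-* (suc K) f b f≤b =
  ≤-trans (+-mono-≤ (sumTo-≤-* K f b f≤b) (f≤b K)) (≤-reflexive (+-comm (K * b) b))

sumTo-+ : ∀ m k (f : ℕ → ℕ) → sumTo (m + k) f ≡ sumTo m f + sumTo k (λ j → f (m + j))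
sumTo-+ m zero f = trans (cong (λ N → sumTo N f) (+-identityʳ m)) (sym (+-identityʳ _))
sumTo-+ m (suc k) f = begin
  sumTo (m + suc k) f                                  ≡⟨ cong (λ N → sumTo N f) (+-suc m k) ⟩
  sumTo (m + k) f + f (m + k)                          ≡⟨ cong (_+ f (m + k)) (sumTo-+ m k f) ⟩
  sumTo m f + sumTo k (λ j → f (m + j)) + f (m + k)    ≡⟨ +-assoc (sumTo m f) _ _ ⟩
  sumTo m f + sumTo (suc k) (λ j → f (m + j))          ∎
  where open ≡-Reasoning

sumTo-≤-+ : ∀ m k (f : ℕ → ℕ) → sumTo m f ≤ sumTo (m + k) f
sumTo-≤-+ m k f = ≤-trans (m≤m+n _ _) (≤-reflexive (sym (sumTo-+ m k f)))

sumTo-vanishing-tail : ∀ {m N} (f : ℕ → ℕ) → (∀ t → m ≤ t → f t ≡ 0) → m ≤ N →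
                       sumTo N f ≡ sumTo m f
sumTo-vanishing-tail {m} {N} f tail≡0 m≤N = begin
  sumTo N f                                       ≡⟨ cong (λ K → sumTo K f) (sym (m+[n∸m]≡n m≤N)) ⟩
  sumTo (m + (N ∸ m)) f                           ≡⟨ sumTo-+ m (N ∸ m) f ⟩
  sumTo m f + sumTo (N ∸ m) (λ j → f (m + j))     ≡⟨ cong (sumTo m f +_) (sumTo-zero (N ∸ m) _ (λ j _ → tail≡0 (m + j) (m≤m+n m j))) ⟩
  sumTo m f + 0                                   ≡⟨ +-identityʳ _ ⟩
  sumTo m f                                       ∎
  where open ≡-Reasoning

sumTo-support : ∀ {a b N} (f : ℕ → ℕ) → (∀ t → t < a → f t ≡ 0) → (∀ t → b ≤ t → f t ≡ 0) →
                b ≤ N → sumTo N f ≡ sumTo (b ∸ a) (λ k → f (a + k))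
sumTo-support {a} {b} {N} f head≡0 tail≡0 b≤N with a ≤? b
... | yes a≤b = begin
  sumTo N f                                       ≡⟨ sumTo-vanishing-tail f tail≡0 b≤N ⟩
  sumTo b f                                       ≡⟨ cong (λ K → sumTo K f) (sym (m+[n∸m]≡n a≤b)) ⟩
  sumTo (a + (b ∸ a)) f                           ≡⟨ sumTo-+ a (b ∸ a) f ⟩
  sumTo a f + sumTo (b ∸ a) (λ k → f (a + k))     ≡⟨ cong (_+ sumTo (b ∸ a) (λ k → f (a + k))) (sumTo-zero a f head≡0) ⟩
  sumTo (b ∸ a) (λ k → f (a + k))                 ∎
  where open ≡-Reasoning
... | no a≰b = begin
  sumTo N f                                       ≡⟨ sumTo-vanishing-tail f tail≡0 b≤N ⟩
  sumTo b f                                       ≡⟨ sumTo-zero b f (λ t t<b → head≡0 t (<-trans t<b b<a)) ⟩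
  0                                               ≡⟨ cong (λ K → sumTo K (λ k → f (a + k))) (sym (m≤n⇒m∸n≡0 (<⇒≤ b<a))) ⟩
  sumTo (b ∸ a) (λ k → f (a + k))                 ∎
  where
  open ≡-Reasoning
  b<a : b < a
  b<a = ≰⇒> a≰b

sumFromTo-vanishing-end : ∀ a b (f : ℕ → ℕ) → (∀ t → b ≤ t → f t ≡ 0) →
                          sumFromTo a b f ≡ sumTo (b ∸ a) (λ k → f (a + k))
sumFromTo-vanishing-end a b f tail≡0 =
  sumTo-vanishing-tail (λ k → f (a + k))
    (λ k b∸a≤k → tail≡0 (a + k) (≤-trans (m≤n+m∸n b a) (+-monoʳ-≤ a b∸a≤k)))
    (∸-monoˡ-≤ a (n≤1+n b))

sumTo≡sumFromTo : ∀ {a b N} (f : ℕ → ℕ) → (∀ t → t < a → f t ≡ 0) → (∀ t → b ≤ t → f t ≡ 0) →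
                  b ≤ N → sumTo N f ≡ sumFromTo a b f
sumTo≡sumFromTo {a} {b} f head≡0 tail≡0 b≤N =
  trans (sumTo-support f head≡0 tail≡0 b≤N) (sym (sumFromTo-vanishing-end a b f tail≡0))

sumFin-cong : ∀ n {f g : Fin n → ℕ} → (∀ i → f i ≡ g i) → sumFin n f ≡ sumFin n g
sumFin-cong zero    f≡g = refl
sumFin-cong (suc n) f≡g = cong₂ _+_ (f≡g Fin.zero) (sumFin-cong n (λ i → f≡g (Fin.suc i)))

sumFin-mono : ∀ n {f g : Fin n → ℕ} → (∀ i → f i ≤ g i) → sumFin n f ≤ sumFin n g
sumFin-mono zero    f≤g = z≤n
sumFin-mono (suc n) f≤g = +-mono-≤ (f≤g Fin.zero) (sumFin-mono n (λ i → f≤g (Fin.suc i)))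

sumFin-zero : ∀ n (f : Fin n → ℕ) → (∀ i → f i ≡ 0) → sumFin n f ≡ 0
sumFin-zero zero    f f≡0 = refl
sumFin-zero (suc n) f f≡0 = cong₂ _+_ (f≡0 Fin.zero) (sumFin-zero n _ (λ i → f≡0 (Fin.suc i)))

sumFin-+ : ∀ n (f g : Fin n → ℕ) → sumFin n (λ i → f i + g i) ≡ sumFin n f + sumFin n g
sumFin-+ zero    f g = refl
sumFin-+ (suc n) f g = begin
  f₀ + g₀ + sumFin n (λ i → f (Fin.suc i) + g (Fin.suc i))  ≡⟨ cong (f₀ + g₀ +_) (sumFin-+ n _ _) ⟩
  f₀ + g₀ + (F′ + G′)                                       ≡⟨ +-assoc f₀ g₀ (F′ + G′) ⟩
  f₀ + (g₀ + (F′ + G′))                                     ≡⟨ cong (f₀ +_) (sym (+-assoc g₀ F′ G′)) ⟩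
  f₀ + (g₀ + F′ + G′)                                       ≡⟨ cong (λ x → f₀ + (x + G′)) (+-comm g₀ F′) ⟩
  f₀ + (F′ + g₀ + G′)                                       ≡⟨ cong (f₀ +_) (+-assoc F′ g₀ G′) ⟩
  f₀ + (F′ + (g₀ + G′))                                     ≡⟨ sym (+-assoc f₀ F′ (g₀ + G′)) ⟩
  f₀ + F′ + (g₀ + G′)                                       ∎
  where
  open ≡-Reasoning
  f₀ g₀ F′ G′ : ℕ
  f₀ = f Fin.zero
  g₀ = g Fin.zero
  F′ = sumFin n (λ i → f (Fin.suc i))
  G′ = sumFin n (λ i → g (Fin.suc i))

sumTo-sumFin-comm : ∀ n N (g : ℕ → Fin n → ℕ) →
                    sumTo N (λ t → sumFin n (g t)) ≡ sumFin n (λ i → sumTo N (λ t → g t i))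
sumTo-sumFin-comm n zero    g = sym (sumFin-zero n _ (λ i → refl))
sumTo-sumFin-comm n (suc N) g =
  trans (cong (_+ sumFin n (g N)) (sumTo-sumFin-comm n N g))
        (sym (sumFin-+ n (λ i → sumTo N (λ t → g t i)) (g N)))

module _ {n : ℕ} where

  slotIndicator : Maybe (Fin n) → Fin n → ℕ
  slotIndicator m i = if isJob m i then 1 else 0

  occupancy : Maybe (Fin n) → ℕ
  occupancy nothing  = 0
  occupancy (just _) = 1

  occupancy≤1 : ∀ m → occupancy m ≤ 1
  occupancy≤1 nothing  = z≤n
  occupancy≤1 (just _) = ≤-refl

  isJob≡true⇒ : ∀ (m : Maybe (Fin n)) i → isJob m i ≡ true → m ≡ just i
  isJob≡true⇒ (just j) i eq with j ≟ᶠ i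
  isJob≡true⇒ (just j) i refl | yes refl = refl

  count-mono : ∀ (a : ℕ → Maybe (Fin n)) i {s t} → s ≤ t → count a i s ≤ count a i t
  count-mono a i {s} {t} s≤t with m≤n⇒m<n∨m≡n s≤t
  ... | inj₂ refl = ≤-refl
  count-mono a i {s} {suc t} _ | inj₁ (s≤s s≤t) = ≤-trans (count-mono a i s≤t) (m≤m+n _ _)

  lastPlusOne≤ : ∀ (a : ℕ → Maybe (Fin n)) i G → lastPlusOne a i G ≤ G
  lastPlusOne≤ a i zero    = z≤n
  lastPlusOne≤ a i (suc G) with isJob (a G) i
  ... | true  = ≤-refl
  ... | false = m≤n⇒m≤1+n (lastPlusOne≤ a i G)

  count-constant-after-last : ∀ (a : ℕ → Maybe (Fin n)) i G {t} →
                              lastPlusOne a i G ≤ t → t ≤ G → count a i t ≡ count a i G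
  count-constant-after-last a i zero    z≤n z≤n = refl
  count-constant-after-last a i (suc G) last≤t t≤G with isJob (a G) i in eq
  ... | true  rewrite ≤-antisym t≤G last≤t | eq = refl
  ... | false with m≤n⇒m<n∨m≡n t≤G
  ...   | inj₂ refl       rewrite eq = refl
  ...   | inj₁ (s≤s t≤G′) = trans (count-constant-after-last a i G last≤t t≤G′) (sym (+-identityʳ _))

sumFin-slotIndicator : ∀ n (m : Maybe (Fin n)) → sumFin n (slotIndicator m) ≡ occupancy m
sumFin-slotIndicator n       nothing             = sumFin-zero n _ (λ i → refl)
sumFin-slotIndicator (suc n) (just Fin.zero)     = cong suc (sumFin-zero n _ (λ i → refl))
sumFin-slotIndicator (suc n) (just (Fin.suc j))  =
  trans (sumFin-cong n shift) (sumFin-slotIndicator n (just j))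
  where
  shift : ∀ i → slotIndicator (just (Fin.suc j)) (Fin.suc i) ≡ slotIndicator (just j) i
  shift i with j ≟ᶠ i
  ... | yes _ = refl
  ... | no _  = refl

module _ {n : ℕ} {r p : Fin n → ℕ} where

  releasedWork : Fin n → ℕ → ℕ
  releasedWork i t with r i ≤? t
  ... | yes _ = p i
  ... | no _  = 0

  totalReleasedWork : ℕ → ℕ
  totalReleasedWork t = sumFin n (λ i → releasedWork i t)

  module _ (A : Schedule n r p) where

    processed : ℕ → ℕ
    processed t = sumFin n (λ i → count (assign A) i t)

    count-since-release : ∀ i t → count (assign A) i t ≤ t ∸ r i
    count-since-release i zero    = z≤n
    count-since-release i (suc t) with isJob (assign A t) i in eq
    ... | false = ≤-trans (≤-reflexive (+-identityʳ _))
                          (≤-trans (count-since-release i t) (∸-monoˡ-≤ (r i) (n≤1+n t)))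
    ... | true  = begin
      count (assign A) i t + 1   ≤⟨ +-monoˡ-≤ 1 (count-since-release i t) ⟩
      t ∸ r i + 1                ≡⟨ +-comm (t ∸ r i) 1 ⟩
      1 + (t ∸ r i)              ≡⟨ sym (+-∸-assoc 1 (released A t i (isJob≡true⇒ (assign A t) i eq))) ⟩
      suc t ∸ r i                ∎
      where open ≤-Reasoning

    count-after-horizon : ∀ i {t} → horizon A ≤ t → count (assign A) i t ≡ p i
    count-after-horizon i {t} H≤t with m≤n⇒m<n∨m≡n H≤t
    ... | inj₂ refl = amount A i
    count-after-horizon i {suc t} _ | inj₁ (s≤s H≤t) rewrite empty A t H≤t =
      trans (+-identityʳ _) (count-after-horizon i H≤t)

    count≤p : ∀ i t → count (assign A) i t ≤ p i
    count≤p i t = ≤-trans (count-mono (assign A) i (m≤m+n t (horizon A)))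
                          (≤-reflexive (count-after-horizon i (m≤n+m (horizon A) t)))

    completion≤horizon : ∀ i → completion A i ≤ horizon A
    completion≤horizon i = lastPlusOne≤ (assign A) i (horizon A)

    count-after-completion : ∀ i {t} → completion A i ≤ t → count (assign A) i t ≡ p i
    count-after-completion i {t} c≤t with t ≤? horizon A
    ... | yes t≤H = trans (count-constant-after-last (assign A) i (horizon A) c≤t t≤H) (amount A i)
    ... | no t≰H  = count-after-horizon i (<⇒≤ (≰⇒> t≰H))

    p≤flow : ∀ i → p i ≤ flow A i
    p≤flow i = subst (_≤ flow A i) (count-after-completion i ≤-refl)
                     (count-since-release i (completion A i))

    qi-active : ∀ {t i} → Active A t i → qi A t i ≡ p i ∸ count (assign A) i t
    qi-active {t} {i} (r≤t , t<c)
      with r i ≤ᵇ t | ≤ᵇ-reflects-≤ (r i) t | t <ᵇ completion A i | <ᵇ-reflects-< t (completion A i)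
    ... | true  | _        | true  | _        = refl
    ... | false | ofⁿ r≰t  | _     | _        = contradiction r≤t r≰t
    ... | true  | _        | false | ofⁿ t≮c  = contradiction t<c t≮c

    qi-inactive : ∀ {t i} → ¬ Active A t i → qi A t i ≡ 0
    qi-inactive {t} {i} inactive
      with r i ≤ᵇ t | ≤ᵇ-reflects-≤ (r i) t | t <ᵇ completion A i | <ᵇ-reflects-< t (completion A i)
    ... | false | _        | _     | _        = refl
    ... | true  | _        | false | _        = refl
    ... | true  | ofʸ r≤t  | true  | ofʸ t<c  = contradiction (r≤t , t<c) inactive

    qi≤p : ∀ t i → qi A t i ≤ p i
    qi≤p t i with (r i ≤ᵇ t) ∧ (t <ᵇ completion A i)
    ... | true  = m∸n≤m (p i) (count (assign A) i t)
    ... | false = z≤n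

    qi-before-release : ∀ i t → t < r i → qi A t i ≡ 0
    qi-before-release i t t<r = qi-inactive (λ (r≤t , _) → <⇒≱ t<r r≤t)

    qi-after-completion : ∀ i t → completion A i ≤ t → qi A t i ≡ 0
    qi-after-completion i t c≤t = qi-inactive (λ (_ , t<c) → <⇒≱ t<c c≤t)

    qi+count≡releasedWork : ∀ t i → qi A t i + count (assign A) i t ≡ releasedWork i t
    qi+count≡releasedWork t i with r i ≤? t
    ... | no r≰t = cong₂ _+_ (qi-inactive (λ (r≤t , _) → r≰t r≤t)) nothing-processed
      where
      nothing-processed : count (assign A) i t ≡ 0
      nothing-processed = n≤0⇒n≡0 (≤-trans (count-since-release i t)
                                            (≤-reflexive (m≤n⇒m∸n≡0 (<⇒≤ (≰⇒> r≰t)))))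
    ... | yes r≤t with t <? completion A i
    ...   | yes t<c = trans (cong (_+ count (assign A) i t) (qi-active (r≤t , t<c)))
                            (m∸n+n≡m (count≤p i t))
    ...   | no t≮c  = cong₂ _+_ (qi-inactive (λ (_ , t<c) → t≮c t<c))
                                (count-after-completion i (≮⇒≥ t≮c))

    count-suc≤releasedWork : ∀ t i → count (assign A) i (suc t) ≤ releasedWork i t
    count-suc≤releasedWork t i with r i ≤? t
    ... | yes _    = count≤p i (suc t)
    ... | no r≰t   = ≤-trans (count-since-release i (suc t))
                             (≤-reflexive (m≤n⇒m∸n≡0 (≰⇒> r≰t)))

    q+processed≡totalReleasedWork : ∀ t → q A t + processed t ≡ totalReleasedWork t
    q+processed≡totalReleasedWork t =
      trans (sym (sumFin-+ n (qi A t) (λ i → count (assign A) i t)))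
            (sumFin-cong n (qi+count≡releasedWork t))

    processed-zero : processed 0 ≡ 0
    processed-zero = sumFin-zero n _ (λ i → refl)

    processed-suc : ∀ t → processed (suc t) ≡ processed t + occupancy (assign A t)
    processed-suc t = trans (sumFin-+ n (λ i → count (assign A) i t) (slotIndicator (assign A t)))
                            (cong (processed t +_) (sumFin-slotIndicator n (assign A t)))

    processed-suc≤totalReleasedWork : ∀ t → processed (suc t) ≤ totalReleasedWork t
    processed-suc≤totalReleasedWork t = sumFin-mono n (count-suc≤releasedWork t)

    sumTo-qi≤flow² : ∀ M i → sumTo M (λ t → qi A t i) ≤ flow A i * flow A i
    sumTo-qi≤flow² M i = begin
      sumTo M qᵢ                                 ≤⟨ sumTo-≤-+ M (horizon A) qᵢ ⟩
      sumTo (M + horizon A) qᵢ                   ≡⟨ sumTo-support qᵢ (qi-before-release i) (qi-after-completion i)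
                                                      (≤-trans (completion≤horizon i) (m≤n+m (horizon A) M)) ⟩
      sumTo (flow A i) (λ k → qᵢ (r i + k))      ≤⟨ sumTo-≤-* (flow A i) _ (p i) (λ k → qi≤p (r i + k) i) ⟩
      flow A i * p i                             ≤⟨ *-monoʳ-≤ (flow A i) (p≤flow i) ⟩
      flow A i * flow A i                        ∎
      where
      open ≤-Reasoning
      qᵢ : ℕ → ℕ
      qᵢ t = qi A t i

    sumTo-q≡sumFin-sumFromTo : sumTo (horizon A) (q A)
                             ≡ sumFin n (λ i → sumFromTo (r i) (completion A i) (λ t → qi A t i))
    sumTo-q≡sumFin-sumFromTo =
      trans (sumTo-sumFin-comm n (horizon A) (qi A))
            (sumFin-cong n (λ i → sumTo≡sumFromTo (λ t → qi A t i)
              (qi-before-release i) (qi-after-completion i) (completion≤horizon i)))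

    sumTo-q≤F : ∀ M → sumTo M (q A) ≤ F A
    sumTo-q≤F M = begin
      sumTo M (q A)                               ≡⟨ sumTo-sumFin-comm n M (qi A) ⟩
      sumFin n (λ i → sumTo M (λ t → qi A t i))   ≤⟨ sumFin-mono n (sumTo-qi≤flow² M) ⟩
      F A                                         ∎
      where open ≤-Reasoning

  module _ (S : Schedule n r p) (wc : WorkConserving S) where

    processed-at-idle : ∀ t → assign S t ≡ nothing → processed S t ≡ totalReleasedWork t
    processed-at-idle t idle =
      trans (cong (_+ processed S t) (sym nothing-remaining)) (q+processed≡totalReleasedWork S t)
      where
      nothing-remaining : q S t ≡ 0
      nothing-remaining = sumFin-zero n _ (λ i → qi-inactive S (λ active → wc t (i , active) idle))

    processed≤work-conserving : ∀ (A : Schedule n r p) t → processed A t ≤ processed S t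
    processed≤work-conserving A zero = ≤-reflexive (trans (processed-zero A) (sym (processed-zero S)))
    processed≤work-conserving A (suc t) = by-slot (assign S t) refl
      where
      open ≤-Reasoning
      by-slot : ∀ m → assign S t ≡ m → processed A (suc t) ≤ processed S (suc t)
      by-slot (just _) busy = begin
        processed A (suc t)                        ≡⟨ processed-suc A t ⟩
        processed A t + occupancy (assign A t)     ≤⟨ +-mono-≤ (processed≤work-conserving A t) (occupancy≤1 _) ⟩
        processed S t + 1                          ≡⟨ cong (λ m → processed S t + occupancy m) (sym busy) ⟩
        processed S t + occupancy (assign S t)     ≡⟨ sym (processed-suc S t) ⟩
        processed S (suc t)                        ∎
      by-slot nothing idle = begin
        processed A (suc t)                        ≤⟨ processed-suc≤totalReleasedWork A t ⟩
        totalReleasedWork t                        ≡⟨ sym (processed-at-idle t idle) ⟩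
        processed S t                              ≤⟨ m≤m+n _ _ ⟩
        processed S t + occupancy (assign S t)     ≡⟨ sym (processed-suc S t) ⟩
        processed S (suc t)                        ∎

    q≤q : ∀ (A : Schedule n r p) t → q S t ≤ q A t
    q≤q A t = +-cancelʳ-≤ (processed S t) (q S t) (q A t) (begin
      q S t + processed S t       ≡⟨ q+processed≡totalReleasedWork S t ⟩
      totalReleasedWork t         ≡⟨ sym (q+processed≡totalReleasedWork A t) ⟩
      q A t + processed A t       ≤⟨ +-monoʳ-≤ (q A t) (processed≤work-conserving A t) ⟩
      q A t + processed S t       ∎)
      where open ≤-Reasoning

    sumTo-q≤F-anySchedule : ∀ (A : Schedule n r p) M → sumTo M (q S) ≤ F A
    sumTo-q≤F-anySchedule A M = ≤-trans (sumTo-mono M (q≤q A)) (sumTo-q≤F A M)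

lemma5p1 : (n : ℕ) (r p : Fin n → ℕ) → (∀ i → 1 ≤ p i)
    → (S : Schedule n r p) → WorkConserving S
    → (OPT : Schedule n r p) → IsOptimal OPT
    → (F OPT ≥ sumTo (horizon S) (q S))
      × (sumTo (horizon S) (q S)
          ≡ sumFin n (λ i → sumFromTo (r i) (completion S i) (λ t → qi S t i)))
lemma5p1 n r p _ S wc OPT _ = sumTo-q≤F-anySchedule S wc OPT (horizon S) , sumTo-q≡sumFin-sumFromTo S
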